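{- Let $n\ge1$. The map $R:\mathrm{Sym}(n+1)\times(\mathbb{Z}/2\mathbb{Z})^{n+1}\to(\mathbb{Z}/2\mathbb{Z})^{n+1}$ and the map $\alpha''_n:\mathrm{Sym}(n+1)\times\mathbb{D}_n\to\mathbb{D}_n$ defined below are both (left) group actions of $\mathrm{Sym}(n+1)$.
   Context: $\mathbb{N}^*=\mathbb{N}\setminus\{0\}$. $\mathrm{Sym}(n+1)$ is the group of bijections of $\{1,\dots,n+1\}$ with product $\sigma\cdot\rho:=\rho\circ\sigma$; $(i\ j)$ is a transposition. $\delta_{i,j}\in\mathbb{Z}/2\mathbb{Z}$ is the Kronecker delta; arithmetic is in $\mathbb{Z}/2\mathbb{Z}$; vectors are columns. $Q(\sigma)$ is the $(n+1)\times(n+1)$ matrix with $Q(\sigma)_{i,j}=\delta_{(n+1\ \sigma(n+1))(\sigma(i)),\,j}+\delta_{\sigma(n+1),j}(1+\delta_{n+1,\sigma(i)})(1+\delta_{\sigma(n+1),n+1})$ (with $(n+1\ n+1)=\mathrm{id}$). Define $R(\sigma,v)=d^\sigma+Q(\sigma)v$ where $d^\sigma_j=(1+\delta_{n+1,\sigma(j)})(1+\delta_{n+1,\sigma(n+1)})$ for $j=1,\dots,n+1$. Let $P_{\mathbb{N}^*}(\sigma)(k_1,\dots,k_{n+1})=(k_{\sigma(1)},\dots,k_{\sigma(n+1)})$. Let $\mathbb{D}_n=\mathrm{Sym}(n+1)\times(\mathbb{N}^*)^{n+1}\times(\mathbb{Z}/2\mathbb{Z})^{n+1}\times\mathbb{Z}/2\mathbb{Z}$,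 and define $\alpha''_n(\sigma,(\sigma',k,v,s))=(\sigma\cdot\sigma',P_{\mathbb{N}^*}(\sigma)(k),R(\sigma,v),s)$. -}

module Defs where

open import Data.Nat using (ℕ; zero; suc; NonZero)
open import Data.Fin using (Fin; zero; suc; fromℕ; _≟_)
open import Data.Fin.Permutation using (Permutation′; _⟨$⟩ʳ_; _∘ₚ_; _≈_)
open import Data.Bool using (Bool; true; false; not; _∧_; _xor_; if_then_else_)
open import Data.Product using (Σ; _×_; _,_)
open import Relation.Nullary.Decidable using (⌊_⌋)
open import Relation.Binary.PropositionalEquality using (_≡_)

-- Sym(n+1) : bijections of Fin (suc n)  (Fin (suc n) ≅ {1,…,n+1}, last element = n+1)
Sym : ℕ → Set
Sym n = Permutation′ (suc n)

-- product σ · ρ := ρ ∘ σ   (stdlib: (σ ∘ₚ ρ) ⟨$⟩ʳ i = ρ ⟨$⟩ʳ (σ ⟨$⟩ʳ i))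
infixl 7 _·_
_·_ : ∀ {n} → Sym n → Sym n → Sym n
σ · ρ = σ ∘ₚ ρ

-- Z/2Z as Bool: addition = xor, multiplication = ∧, 1 = true
Z2 : Set
Z2 = Bool

δ : ∀ {m} → Fin m → Fin m → Z2
δ i j = ⌊ i ≟ j ⌋

Σ2 : ∀ {m} → (Fin m → Z2) → Z2
Σ2 {zero}  f = false
Σ2 {suc m} f = f zero xor Σ2 (λ i → f (suc i))

last : ∀ n → Fin (suc n)
last n = fromℕ n

transp : ∀ {m} → Fin m → Fin m → Fin m → Fin m
transp a b x = if δ x a then b else (if δ x b then a else x)

Q : ∀ {n} → Sym n → Fin (suc n) → Fin (suc n) → Z2
Q {n} σ i j =
  δ (transp (last n) (σ ⟨$⟩ʳ last n) (σ ⟨$⟩ʳ i)) j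
  xor (δ (σ ⟨$⟩ʳ last n) j ∧ not (δ (last n) (σ ⟨$⟩ʳ i)) ∧ not (δ (σ ⟨$⟩ʳ last n) (last n)))

d : ∀ {n} → Sym n → Fin (suc n) → Z2
d {n} σ j = not (δ (last n) (σ ⟨$⟩ʳ j)) ∧ not (δ (last n) (σ ⟨$⟩ʳ last n))

R : ∀ {n} → Sym n → (Fin (suc n) → Z2) → (Fin (suc n) → Z2)
R σ v i = d σ i xor Σ2 (λ j → Q σ i j ∧ v j)

ℕ* : Set
ℕ* = Σ ℕ NonZero

P : ∀ {n} → Sym n → (Fin (suc n) → ℕ*) → (Fin (suc n) → ℕ*)
P σ k i = k (σ ⟨$⟩ʳ i)

𝔻 : ℕ → Set
𝔻 n = Sym n × (Fin (suc n) → ℕ*) × (Fin (suc n) → Z2) × Z2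

α'' : ∀ {n} → Sym n → 𝔻 n → 𝔻 n
α'' σ (σ' , k , v , s) = (σ · σ' , P σ k , R σ v , s)

_≈V_ : ∀ {n} → (Fin (suc n) → Z2) → (Fin (suc n) → Z2) → Set
v ≈V w = ∀ i → v i ≡ w i

_≈𝔻_ : ∀ {n} → 𝔻 n → 𝔻 n → Set
(σ , k , v , s) ≈𝔻 (σ' , k' , v' , s') =
  (σ ≈ σ') × (∀ i → k i ≡ k' i) × (∀ i → v i ≡ v' i) × (s ≡ s')

IsLeftAction : ∀ {n} {X : Set} → (X → X → Set) → (Sym n → X → X) → Set
IsLeftAction {n} {X} _≈X_ act =
  (∀ x → act Data.Fin.Permutation.id x ≈X x) ×
  (∀ (σ ρ : Sym n) x → act (σ · ρ) x ≈X act σ (act ρ x))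

-- Put L = n+1 and let twist L be the involution v ↦ v + (1 + v_L)(𝟙 − e_L) of (Z/2Z)^{n+1}.
-- Then R(σ, v) = twist L (twist L v ∘ σ): R is the coordinate action v ↦ v ∘ σ (a left action
-- for the product σ · ρ = ρ ∘ σ) conjugated by a fixed involution, hence itself a left action.
-- The one computation is R(σ, v)_i = twist (σ L) (twist L v) (σ i), a case check on whether
-- σ i and σ L equal L or each other. On the other components of 𝔻_n, α'' acts by left
-- multiplication and by k ↦ k ∘ σ, which are actions on the nose.
module Submission where

open import Defs
open import Algebra.Bundles using (CommutativeRing)
open import Data.Bool using (true; false; not; _∧_; _xor_)
open import Data.Bool.Properties
  using (xor-∧-commutativeRing; xor-identityʳ; xor-assoc; xor-same; ∧-assoc; ∧-distribʳ-xor)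
open import Algebra.Properties.CommutativeSemigroup
  (CommutativeRing.+-commutativeSemigroup xor-∧-commutativeRing) using (interchange)
open import Data.Bool.Solver using (module xor-∧-Solver)
open xor-∧-Solver using (Polynomial; solve; _:=_; _:+_; _:*_; con)
open import Data.Fin using (Fin; zero; suc; _≟_)
open import Data.Fin.Properties using (suc-injective)
open import Data.Fin.Permutation using (_⟨$⟩ʳ_; id)
open import Data.Nat using (ℕ; zero; suc; _≤_)
open import Data.Product using (_×_; _,_)
open import Function using (_∘_; Injection; _⇔_; mk⇔)
open import Function.Properties.Inverse using (↔⇒↣)
open import Relation.Nullary using (yes; no; contradiction)
open import Relation.Nullary.Decidable using (isYes≗does; dec-true; dec-false; does-⇔)
open import Relation.Binary.PropositionalEquality
  using (_≡_; _≢_; _≗_; refl; sym; trans; cong; cong₂; ≢-sym; module ≡-Reasoning)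

δ-refl : ∀ {m} (x : Fin m) → δ x x ≡ true
δ-refl x = trans (isYes≗does (x ≟ x)) (dec-true (x ≟ x) refl)

δ-≢ : ∀ {m} {x y : Fin m} → x ≢ y → δ x y ≡ false
δ-≢ {x = x} {y} x≢y = trans (isYes≗does (x ≟ y)) (dec-false (x ≟ y) x≢y)

δ-⇔ : ∀ {m} {x y x′ y′ : Fin m} → x ≡ y ⇔ x′ ≡ y′ → δ x y ≡ δ x′ y′
δ-⇔ {x = x} {y} {x′} {y′} e =
  trans (isYes≗does (x ≟ y)) (trans (does-⇔ e (x ≟ y) (x′ ≟ y′)) (sym (isYes≗does (x′ ≟ y′))))

δ-sym : ∀ {m} (x y : Fin m) → δ x y ≡ δ y x
δ-sym x y = δ-⇔ (mk⇔ sym sym)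

δ-permute : ∀ {n} (σ : Sym n) i j → δ (σ ⟨$⟩ʳ i) (σ ⟨$⟩ʳ j) ≡ δ i j
δ-permute σ i j = δ-⇔ (mk⇔ (Injection.injective (↔⇒↣ σ)) (cong (σ ⟨$⟩ʳ_)))

Σ2-cong : ∀ {m} {f g : Fin m → Z2} → f ≗ g → Σ2 f ≡ Σ2 g
Σ2-cong {zero}  f≗g = refl
Σ2-cong {suc m} f≗g = cong₂ _xor_ (f≗g zero) (Σ2-cong (f≗g ∘ suc))

Σ2-xor : ∀ {m} (f g : Fin m → Z2) → Σ2 (λ j → f j xor g j) ≡ Σ2 f xor Σ2 g
Σ2-xor {zero}  f g = refl
Σ2-xor {suc m} f g = trans (cong ((f zero xor g zero) xor_) (Σ2-xor (f ∘ suc) (g ∘ suc)))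
                           (interchange (f zero) (g zero) (Σ2 (f ∘ suc)) (Σ2 (g ∘ suc)))

Σ2-supported : ∀ {m} (f : Fin m → Z2) (a : Fin m) → (∀ j → j ≢ a → f j ≡ false) → Σ2 f ≡ f a
Σ2-supported {suc m} f zero f≡0 =
  trans (cong (f zero xor_) (Σ2-vanishes (f ∘ suc) (λ j → f≡0 (suc j) λ ()))) (xor-identityʳ (f zero))
  where
  Σ2-vanishes : ∀ {k} (g : Fin k → Z2) → (∀ j → g j ≡ false) → Σ2 g ≡ false
  Σ2-vanishes {zero}  g g≡0 = refl
  Σ2-vanishes {suc k} g g≡0 = trans (cong (_xor Σ2 (g ∘ suc)) (g≡0 zero)) (Σ2-vanishes (g ∘ suc) (g≡0 ∘ suc))
Σ2-supported {suc m} f (suc a) f≡0 =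
  trans (cong (_xor Σ2 (f ∘ suc)) (f≡0 zero λ ()))
        (Σ2-supported (f ∘ suc) a (λ j j≢a → f≡0 (suc j) (j≢a ∘ suc-injective)))

Σ2-δ : ∀ {m} (a : Fin m) (v : Fin m → Z2) → Σ2 (λ j → δ a j ∧ v j) ≡ v a
Σ2-δ a v = trans (Σ2-supported (λ j → δ a j ∧ v j) a (λ j j≢a → cong (_∧ v j) (δ-≢ (≢-sym j≢a))))
                 (cong (_∧ v a) (δ-refl a))

Σ2-δ-xor-δ : ∀ {m} (t b : Fin m) (c : Z2) (v : Fin m → Z2) →
  Σ2 (λ j → (δ t j xor δ b j ∧ c) ∧ v j) ≡ v t xor (c ∧ v b)
Σ2-δ-xor-δ t b c v = begin
  Σ2 (λ j → (δ t j xor δ b j ∧ c) ∧ v j)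
    ≡⟨ Σ2-cong (λ j → trans (∧-distribʳ-xor (v j) (δ t j) _) (cong (δ t j ∧ v j xor_) (∧-assoc (δ b j) c (v j)))) ⟩
  Σ2 (λ j → δ t j ∧ v j xor δ b j ∧ (c ∧ v j))
    ≡⟨ Σ2-xor (λ j → δ t j ∧ v j) (λ j → δ b j ∧ (c ∧ v j)) ⟩
  Σ2 (λ j → δ t j ∧ v j) xor Σ2 (λ j → δ b j ∧ (c ∧ v j))
    ≡⟨ cong₂ _xor_ (Σ2-δ t v) (Σ2-δ b (λ j → c ∧ v j)) ⟩
  v t xor (c ∧ v b) ∎
  where open ≡-Reasoning

twist : ∀ {m} → Fin m → (Fin m → Z2) → Fin m → Z2
twist L v j = (not (δ j L) ∧ not (v L)) xor v j

twist-base : ∀ {m} (L : Fin m) (v : Fin m → Z2) → twist L v L ≡ v L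
twist-base L v = cong (λ e → (not e ∧ not (v L)) xor v L) (δ-refl L)

twist-involutive : ∀ {m} (L : Fin m) (v : Fin m → Z2) → twist L (twist L v) ≗ v
twist-involutive L v j = begin
  (not (δ j L) ∧ not (twist L v L)) xor twist L v j
    ≡⟨ cong (λ x → (not (δ j L) ∧ not x) xor twist L v j) (twist-base L v) ⟩
  s xor (s xor v j) ≡⟨ xor-assoc s s (v j) ⟨
  (s xor s) xor v j ≡⟨ cong (_xor v j) (xor-same s) ⟩
  v j               ∎
  where
  open ≡-Reasoning
  s = not (δ j L) ∧ not (v L)

twist-cong : ∀ {m} (L : Fin m) {v w : Fin m → Z2} → v ≗ w → twist L v ≗ twist L w
twist-cong L v≗w j = cong₂ (λ x y → (not (δ j L) ∧ not x) xor y) (v≗w L) (v≗w j)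

twist-permute : ∀ {n} (σ : Sym n) (L : Fin (suc n)) (u : Fin (suc n) → Z2) →
  twist L (u ∘ (σ ⟨$⟩ʳ_)) ≗ twist (σ ⟨$⟩ʳ L) u ∘ (σ ⟨$⟩ʳ_)
twist-permute σ L u i = cong (λ e → (not e ∧ not (u (σ ⟨$⟩ʳ L))) xor u (σ ⟨$⟩ʳ i)) (sym (δ-permute σ i L))

:not : ∀ {k} → Polynomial k → Polynomial k
:not p = con true :+ p

row≡twist-twist : ∀ {m} (L a b : Fin m) (v : Fin m → Z2) →
  (not (δ a L) ∧ not (δ b L) ∧ not (v b)) xor v (transp L b a) ≡ twist b (twist L v) a
row≡twist-twist L a b v with a ≟ b
... | yes refl with a ≟ L
...   | yes refl = refl
...   | no a≢L = solve 2 (λ x l → :not x :+ l := :not l :+ x) refl (v a) (v L)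
row≡twist-twist L a b v | no a≢b with a ≟ L | b ≟ L
...   | yes refl | yes refl = contradiction refl a≢b
...   | yes refl | no b≢L = solve 2 (λ y l → y := :not (:not l :+ y) :+ l) refl (v b) (v a)
...   | no a≢L | yes refl = solve 2 (λ x l → x := :not l :+ (:not l :+ x)) refl (v a) (v b)
...   | no a≢L | no b≢L =
  solve 3 (λ x y l → :not y :+ x := :not (:not l :+ y) :+ (:not l :+ x)) refl (v a) (v b) (v L)

R-explicit : ∀ {n} (σ : Sym n) v i → let L = last n; a = σ ⟨$⟩ʳ i; b = σ ⟨$⟩ʳ last n in
  R σ v i ≡ (not (δ a L) ∧ not (δ b L) ∧ not (v b)) xor v (transp L b a)
R-explicit {n} σ v i = begin
  d σ i xor Σ2 (λ j → Q σ i j ∧ v j)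
    ≡⟨ cong (d σ i xor_) (Σ2-δ-xor-δ t b (not (δ L a) ∧ not (δ b L)) v) ⟩
  (not (δ L a) ∧ not (δ L b)) xor (v t xor ((not (δ L a) ∧ not (δ b L)) ∧ v b))
    ≡⟨ cong₂ (λ p q → (not p ∧ not q) xor (v t xor ((not p ∧ not (δ b L)) ∧ v b))) (δ-sym L a) (δ-sym L b) ⟩
  (not (δ a L) ∧ not (δ b L)) xor (v t xor ((not (δ a L) ∧ not (δ b L)) ∧ v b))
    ≡⟨ solve 4 (λ p q x y → (p :* q) :+ (y :+ ((p :* q) :* x)) := (p :* (q :* :not x)) :+ y) refl
             (not (δ a L)) (not (δ b L)) (v b) (v t) ⟩
  (not (δ a L) ∧ not (δ b L) ∧ not (v b)) xor v t ∎
  where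
  open ≡-Reasoning
  L = last n
  a = σ ⟨$⟩ʳ i
  b = σ ⟨$⟩ʳ L
  t = transp L b a

R-conjugate : ∀ {n} (σ : Sym n) (v : Fin (suc n) → Z2) →
  R σ v ≗ twist (last n) (twist (last n) v ∘ (σ ⟨$⟩ʳ_))
R-conjugate {n} σ v i = begin
  R σ v i                                 ≡⟨ R-explicit σ v i ⟩
  _                                       ≡⟨ row≡twist-twist L (σ ⟨$⟩ʳ i) (σ ⟨$⟩ʳ L) v ⟩
  twist (σ ⟨$⟩ʳ L) (twist L v) (σ ⟨$⟩ʳ i) ≡⟨ twist-permute σ L (twist L v) i ⟨
  twist L (twist L v ∘ (σ ⟨$⟩ʳ_)) i       ∎
  where
  open ≡-Reasoning
  L = last n

R-identity : ∀ {n} (v : Fin (suc n) → Z2) → R id v ≈V v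
R-identity {n} v i = trans (R-conjugate id v i) (twist-involutive (last n) v i)

R-compose : ∀ {n} (σ ρ : Sym n) (v : Fin (suc n) → Z2) → R (σ · ρ) v ≈V R σ (R ρ v)
R-compose {n} σ ρ v i = begin
  R (σ · ρ) v i                                 ≡⟨ R-conjugate (σ · ρ) v i ⟩
  twist L (twist L v ∘ (ρ ⟨$⟩ʳ_) ∘ (σ ⟨$⟩ʳ_)) i ≡⟨ twist-cong L (twist-R ∘ (σ ⟨$⟩ʳ_)) i ⟨
  twist L (twist L (R ρ v) ∘ (σ ⟨$⟩ʳ_)) i       ≡⟨ R-conjugate σ (R ρ v) i ⟨
  R σ (R ρ v) i                                 ∎
  where
  open ≡-Reasoning
  L = last n
  twist-R : twist L (R ρ v) ≗ twist L v ∘ (ρ ⟨$⟩ʳ_)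
  twist-R j = trans (twist-cong L (R-conjugate ρ v) j) (twist-involutive L (twist L v ∘ (ρ ⟨$⟩ʳ_)) j)

α''-identity : ∀ {n} (x : 𝔻 n) → α'' id x ≈𝔻 x
α''-identity (σ′ , k , v , s) = (λ _ → refl) , (λ _ → refl) , R-identity v , refl

α''-compose : ∀ {n} (σ ρ : Sym n) (x : 𝔻 n) → α'' (σ · ρ) x ≈𝔻 α'' σ (α'' ρ x)
α''-compose σ ρ (σ′ , k , v , s) = (λ _ → refl) , (λ _ → refl) , R-compose σ ρ v , refl

mainTheorem6 : ∀ (n : ℕ) → 1 ≤ n →
    IsLeftAction {n} _≈V_ R × IsLeftAction {n} _≈𝔻_ α''
mainTheorem6 n _ = (R-identity , R-compose) , (α''-identity , α''-compose)
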